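{- Fix $k\ge2$ and write $A_xy=A_x(k,y)$. Let $a\ge1$, $b$, $e$ be natural numbers, let $m\equiv_k A_ab$, let $m_{ -1}$ denote the penultimate sandwiching value of $m$, and let $w=A_{a-1}e$. Then $w\equiv_k A_{a-1}e$ if either (1) $A_{a-1}m_{ -1}\le w<A_am_{ -1}$, or (2) $A_{a-1}m\le w<A_a(b+1)$.
   Context: Ackermann function: for $k\ge 2$, $a,b\ge 0$: $A_a(k,-1):=1$, $A_0(k,b):=k^b$, $A_{a+1}(k,b):=A_a(k,\cdot)^k(A_{a+1}(k,b-1))$, with $f^j$ the $j$-fold iterate. $k$-normal form and sandwiching: for $m>0$, $m\equiv_k A_ab+c$ means $m=A_ab+c$ and there exist $n\ge1$ and naturals $a_1..a_n$, $b_1..b_n$, $m_0..m_n$ (sandwiching values) with $m_0=0$; for $0\le i<n$: $A_{a_{i+1}}m_i\le m<A_{a_{i+1}+1}m_i$, $A_{a_{i+1}}b_{i+1}\le m<A_{a_{i+1}}(b_{i+1}+1)$, $m_{i+1}=A_{a_{i+1}}b_{i+1}$; $A_0m_n>m$; $a=a_n$, $b=b_n$. These data are uniquely determined by $m$. The penultimate sandwiching value of $m$ is $m_{ -1}:=m_{n-1}$ (so $m_{ -1}=0$ if $n=1$). $m\equiv_k A_ab$ means $m\equiv_k A_ab+0$. -}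

module Defs where

open import Data.Nat using (ℕ; zero; suc; _+_; _^_; _≤_; _<_)
open import Data.Product using (Σ; _×_; ∃)
open import Relation.Binary.PropositionalEquality using (_≡_)

iter : (ℕ → ℕ) → ℕ → ℕ → ℕ
iter f zero x = x
iter f (suc j) x = f (iter f j x)

-- Ack k a b = A_a(k, b) for b ≥ 0.  The value A_a(k,-1) = 1 is built in:
-- A_{a+1}(k,0) = A_a(k,·)^k (A_{a+1}(k,-1)) = A_a(k,·)^k (1).
Ack : ℕ → ℕ → ℕ → ℕ
Ack k zero b = k ^ b
Ack k (suc a) zero = iter (Ack k a) k 1
Ack k (suc a) (suc b) = iter (Ack k a) k (Ack k (suc a) b)

-- Sandwiching data for m: n, a_1..a_n (as 1 .. as n), b_1..b_n, m_0..m_n.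
-- (Values of the sequences outside these index ranges are irrelevant.)
record Sandwich (k m n : ℕ) (as bs ms : ℕ → ℕ) : Set where
  field
    n≥1   : 1 ≤ n
    m₀≡0  : ms 0 ≡ 0
    step  : ∀ i → i < n →
              (Ack k (as (suc i)) (ms i) ≤ m)
            × (m < Ack k (suc (as (suc i))) (ms i))
            × (Ack k (as (suc i)) (bs (suc i)) ≤ m)
            × (m < Ack k (as (suc i)) (suc (bs (suc i))))
            × (ms (suc i) ≡ Ack k (as (suc i)) (bs (suc i)))
    last  : m < Ack k 0 (ms n)

record NFWith (k m a b c n : ℕ) (as bs ms : ℕ → ℕ) : Set where
  field
    pos      : 0 < m
    eqn      : m ≡ Ack k a b + c
    sandwich : Sandwich k m n as bs ms
    a≡aₙ     : a ≡ as n
    b≡bₙ     : b ≡ bs n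

NF : (k m a b c : ℕ) → Set
NF k m a b c = Σ ℕ λ n → Σ (ℕ → ℕ) λ as → Σ (ℕ → ℕ) λ bs → Σ (ℕ → ℕ) λ ms →
  NFWith k m a b c n as bs ms

-- The sandwiching data of w = A_{a-1} e are a prefix of those of m (the first n-1 steps in
-- case (1), all n steps in case (2)) followed by the single step (a-1, e).  Step i of a
-- sandwich constrains the number only to lie in [m_{i+1}, A_{a_{i+1}}(b_{i+1}+1)), so it
-- suffices to place w in these intervals: in case (1) m_{n-1} ≤ w < m, and in case (2)
-- m ≤ w < A_a(b+1) ≤ A_{a_i}(b_i+1), because a_i ≥ a and every value of A_{a_i} is a value
-- of A_a.
module Submission where

open import Defs
open import Data.Nat
  using (ℕ; zero; suc; _+_; _∸_; _≤_; _<_; _≥_; _≤′_; ≤′-refl; ≤′-step; z≤n; s≤s; z<s; _≤?_)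
open import Data.Nat.Properties
open import Data.Sum using (_⊎_; inj₁; inj₂)
open import Data.Product using (_×_; ∃; _,_)
open import Function using (flip)
open import Relation.Binary.Core using (Rel)
open import Relation.Binary.Definitions using (Reflexive; Transitive)
open import Relation.Nullary using (yes; no; contradiction)
open import Relation.Binary.PropositionalEquality
  using (_≡_; refl; sym; trans; subst; cong₂; module ≡-Reasoning)

stepwise⇒chain : ∀ {ℓ} {R : Rel ℕ ℓ} → Reflexive R → Transitive R →
  (f : ℕ → ℕ) {n : ℕ} → (∀ i → i < n → R (f i) (f (suc i))) →
  ∀ {i j} → i ≤ j → j ≤ n → R (f i) (f j)
stepwise⇒chain {R = R} refl′ trans′ f {n} step i≤j = go (≤⇒≤′ i≤j)
  where
  go : ∀ {i j} → i ≤′ j → j ≤ n → R (f i) (f j)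
  go ≤′-refl         _   = refl′
  go (≤′-step i≤′j) j<n = trans′ (go i≤′j (<⇒≤ j<n)) (step _ j<n)

strictlyIncreasing⇒inflationary : ∀ {f : ℕ → ℕ} → 0 < f 0 →
  (∀ y → f y < f (suc y)) → ∀ y → y < f y
strictlyIncreasing⇒inflationary f0>0 _   zero    = f0>0
strictlyIncreasing⇒inflationary f0>0 inc (suc y) =
  ≤-<-trans (strictlyIncreasing⇒inflationary f0>0 inc y) (inc y)

module _ {f : ℕ → ℕ} (inflationary : ∀ x → x < f x) where

  iter-inflationary : ∀ j x → x ≤ iter f j x
  iter-inflationary zero    x = ≤-refl
  iter-inflationary (suc j) x = ≤-trans (iter-inflationary j x) (<⇒≤ (inflationary _))

  iter-strict : ∀ {j} → 0 < j → ∀ x → x < iter f j x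
  iter-strict {suc j} _ x = ≤-<-trans (iter-inflationary j x) (inflationary _)

  f≤iter : (∀ {x y} → x ≤ y → f x ≤ f y) → ∀ {j} → 0 < j → ∀ x → f x ≤ iter f j x
  f≤iter mono {suc j} _ x = mono (iter-inflationary j x)

iter-last : ∀ (f : ℕ → ℕ) {j} → 0 < j → ∀ x → ∃ λ x′ → iter f j x ≡ f x′
iter-last f {suc j} _ x = iter f j x , refl

-- Step i of  Sandwich k m n as bs ms,  with c = a_{i+1}, b = b_{i+1}, x = m_i, y = m_{i+1}.
-- A record rather than the product used there, so that its indices can be inferred
-- (Ack is not injective).
record SandwichStep (k m c b x y : ℕ) : Set where
  constructor sandwichStep
  field
    base-lower  : Ack k c x ≤ m
    base-upper  : m < Ack k (suc c) x
    bound-lower : Ack k c b ≤ m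
    bound-upper : m < Ack k c (suc b)
    value       : y ≡ Ack k c b

cutoff : (ℕ → ℕ) → ℕ → ℕ → ℕ → ℕ
cutoff f p v j with j ≤? p
... | yes _ = f j
... | no  _ = v

cutoff-≤ : ∀ f {p v j} → j ≤ p → cutoff f p v j ≡ f j
cutoff-≤ f {p} {j = j} j≤p with j ≤? p
... | yes _   = refl
... | no  j≰p = contradiction j≤p j≰p

cutoff-suc : ∀ f p v → cutoff f p v (suc p) ≡ v
cutoff-suc f p v with suc p ≤? p
... | yes p<p = contradiction p<p (n≮n p)
... | no  _   = refl

module _ {k : ℕ} (1<k : 1 < k) where

  private
    0<k : 0 < k
    0<k = <-trans z<s 1<k

  Ack-<-suc : ∀ c y → Ack k c y < Ack k c (suc y)
  Ack-inflationary : ∀ c y → y < Ack k c y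

  Ack-pos : ∀ c → 0 < Ack k c 0
  Ack-pos zero    = z<s
  Ack-pos (suc c) = iter-inflationary (Ack-inflationary c) k 1

  Ack-<-suc zero    y = ^-monoʳ-< k 1<k (n<1+n y)
  Ack-<-suc (suc c) y = iter-strict (Ack-inflationary c) 0<k (Ack k (suc c) y)

  Ack-inflationary c = strictlyIncreasing⇒inflationary (Ack-pos c) (Ack-<-suc c)

  Ack-monoʳ-≤ : ∀ c {x y} → x ≤ y → Ack k c x ≤ Ack k c y
  Ack-monoʳ-≤ c x≤y =
    stepwise⇒chain {R = _≤_} ≤-refl ≤-trans (Ack k c) (λ y _ → <⇒≤ (Ack-<-suc c y)) x≤y ≤-refl

  Ack-cancelʳ-< : ∀ c {x y} → Ack k c x < Ack k c y → x < y
  Ack-cancelʳ-< c {x} {y} A[x]<A[y] with y ≤? x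
  ... | yes y≤x = contradiction (Ack-monoʳ-≤ c y≤x) (<⇒≱ A[x]<A[y])
  ... | no  y≰x = ≰⇒> y≰x

  Ack-≤-Ack-suc : ∀ c y → Ack k c y ≤ Ack k (suc c) y
  Ack-≤-Ack-suc c zero    =
    ≤-trans (Ack-monoʳ-≤ c z≤n) (f≤iter (Ack-inflationary c) (Ack-monoʳ-≤ c) 0<k 1)
  Ack-≤-Ack-suc c (suc y) =
    ≤-trans (Ack-monoʳ-≤ c (Ack-inflationary (suc c) y))
            (f≤iter (Ack-inflationary c) (Ack-monoʳ-≤ c) 0<k (Ack k (suc c) y))

  Ack-monoˡ-≤ : ∀ {c d} y → c ≤ d → Ack k c y ≤ Ack k d y
  Ack-monoˡ-≤ y c≤d =
    stepwise⇒chain {R = _≤_} ≤-refl ≤-trans (λ c → Ack k c y) (λ c _ → Ack-≤-Ack-suc c y) c≤d ≤-refl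

  Ack-range-⊆ : ∀ {c d} → c ≤ d → ∀ y → ∃ λ z → Ack k d y ≡ Ack k c z
  Ack-range-⊆ {c} c≤d = go (≤⇒≤′ c≤d)
    where
    Ack-suc-value : ∀ d x → ∃ λ z → Ack k (suc d) x ≡ Ack k d z
    Ack-suc-value d zero    = iter-last (Ack k d) 0<k 1
    Ack-suc-value d (suc x) = iter-last (Ack k d) 0<k (Ack k (suc d) x)

    go : ∀ {d} → c ≤′ d → ∀ y → ∃ λ z → Ack k d y ≡ Ack k c z
    go ≤′-refl              y = y , refl
    go (≤′-step {d} c≤′d) y =
      let (z′ , A[d+1,y]≡A[d,z′]) = Ack-suc-value d y
          (z  , A[d,z′]≡A[c,z])   = go c≤′d z′
      in z , trans A[d+1,y]≡A[d,z′] A[d,z′]≡A[c,z]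

  Ack-suc-≤-coarser : ∀ {c d b m y} → c ≤ d →
    Ack k c b ≤ m → m < Ack k d y → Ack k c (suc b) ≤ Ack k d y
  Ack-suc-≤-coarser {c} {b = b} {m} {y} c≤d A[c,b]≤m m<A[d,y] =
    let (z , A[d,y]≡A[c,z]) = Ack-range-⊆ c≤d y
        b<z = Ack-cancelʳ-< c (≤-<-trans A[c,b]≤m (subst (m <_) A[d,y]≡A[c,z] m<A[d,y]))
    in subst (Ack k c (suc b) ≤_) (sym A[d,y]≡A[c,z]) (Ack-monoʳ-≤ c b<z)

  step-base≤bound : ∀ {m c b x y} → SandwichStep k m c b x y → x ≤ b
  step-base≤bound {c = c} st = m<1+n⇒m≤n (Ack-cancelʳ-< c (≤-<-trans base-lower bound-upper))
    where open SandwichStep st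

  step-base≤value : ∀ {m c b x y} → SandwichStep k m c b x y → x ≤ y
  step-base≤value {c = c} {x = x} st@(sandwichStep _ _ _ _ refl) =
    ≤-trans (<⇒≤ (Ack-inflationary c x)) (Ack-monoʳ-≤ c (step-base≤bound st))

  step-value≤ : ∀ {m c b x y} → SandwichStep k m c b x y → y ≤ m
  step-value≤ (sandwichStep _ _ A[c,b]≤m _ refl) = A[c,b]≤m

  step-retarget : ∀ {m w c b x y} → SandwichStep k m c b x y →
    y ≤ w → w < Ack k c (suc b) → SandwichStep k w c b x y
  step-retarget {c = c} {x = x} st@(sandwichStep _ m<A[c+1,x] A[c,b]≤m _ refl) y≤w w<A[c,b+1] =
    sandwichStep
      (≤-trans (Ack-monoʳ-≤ c (step-base≤bound st)) y≤w)
      (<-≤-trans w<A[c,b+1] (Ack-suc-≤-coarser {y = x} (n≤1+n c) A[c,b]≤m m<A[c+1,x]))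
      y≤w
      w<A[c,b+1]
      refl

  module _ {m n : ℕ} {as bs ms : ℕ → ℕ} (sw : Sandwich k m n as bs ms) where
    open Sandwich sw

    stepAt : ∀ i → i < n → SandwichStep k m (as (suc i)) (bs (suc i)) (ms i) (ms (suc i))
    stepAt i i<n =
      let (base-lower , base-upper , bound-lower , bound-upper , value) = step i i<n
      in sandwichStep base-lower base-upper bound-lower bound-upper value

    ms-mono : ∀ {i j} → i ≤ j → j ≤ n → ms i ≤ ms j
    ms-mono = stepwise⇒chain {R = _≤_} ≤-refl ≤-trans ms (λ i i<n → step-base≤value (stepAt i i<n))

    as-step : ∀ i → suc i < n → as (suc (suc i)) ≤ as (suc i)
    as-step i i+1<n = ≮⇒≥ λ a<a′ →
      <⇒≱ (base-upper stᵢ)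
        (≤-trans (Ack-monoʳ-≤ (suc (as (suc i))) (step-base≤value stᵢ))
        (≤-trans (Ack-monoˡ-≤ _ a<a′) (base-lower (stepAt (suc i) i+1<n))))
      where
      open SandwichStep
      stᵢ = stepAt i (<⇒≤ i+1<n)

    as-antitone : ∀ {i j} → i ≤ j → j < n → as (suc j) ≤ as (suc i)
    as-antitone {j = j} i≤j j<n =
      stepwise⇒chain {R = _≥_} ≤-refl (flip ≤-trans) (λ i → as (suc i)) {j}
        (λ i i<j → as-step i (<-≤-trans (s≤s i<j) j<n)) i≤j ≤-refl

  NFWith⇒ms≡m : ∀ {m a b p as bs ms} → NFWith k m a b 0 (suc p) as bs ms → ms (suc p) ≡ m
  NFWith⇒ms≡m {m} {a} {b} {p} {as} {bs} {ms} nf = begin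
    ms (suc p)                      ≡⟨ SandwichStep.value (stepAt sandwich p ≤-refl) ⟩
    Ack k (as (suc p)) (bs (suc p)) ≡⟨ cong₂ (Ack k) (sym a≡aₙ) (sym b≡bₙ) ⟩
    Ack k a b                       ≡⟨ sym (+-identityʳ _) ⟩
    Ack k a b + 0                   ≡⟨ sym eqn ⟩
    m                               ∎
    where
    open NFWith nf
    open ≡-Reasoning

  extend-sandwich : ∀ {c e p} {as bs ms : ℕ → ℕ} → ms 0 ≡ 0 →
    (∀ i → i < p → SandwichStep k (Ack k c e) (as (suc i)) (bs (suc i)) (ms i) (ms (suc i))) →
    Ack k c (ms p) ≤ Ack k c e → Ack k c e < Ack k (suc c) (ms p) →
    NF k (Ack k c e) c e 0
  extend-sandwich {c} {e} {p} {as} {bs} {ms} m₀≡0 steps w-lower w-upper =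
    suc p , as′ , bs′ , ms′ , record
      { pos      = ≤-<-trans z≤n (Ack-inflationary c e)
      ; eqn      = sym (+-identityʳ w)
      ; sandwich = record
        { n≥1  = s≤s z≤n
        ; m₀≡0 = trans (cutoff-≤ ms {p} {w} z≤n) m₀≡0
        ; step = λ i i<p+1 → let open SandwichStep (step′ i i<p+1)
                             in base-lower , base-upper , bound-lower , bound-upper , value
        ; last = subst (λ t → w < Ack k 0 t) (sym (cutoff-suc ms p w)) (Ack-inflationary 0 w) }
      ; a≡aₙ     = sym (cutoff-suc as p c)
      ; b≡bₙ     = sym (cutoff-suc bs p e) }
    where
    w   = Ack k c e
    as′ = cutoff as p c
    bs′ = cutoff bs p e
    ms′ = cutoff ms p w
    step′ : ∀ i → i < suc p → SandwichStep k w (as′ (suc i)) (bs′ (suc i)) (ms′ i) (ms′ (suc i))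
    step′ i i<p+1 with m<1+n⇒m<n∨m≡n i<p+1
    ... | inj₁ i<p
      rewrite cutoff-≤ as {v = c} i<p | cutoff-≤ bs {v = e} i<p
            | cutoff-≤ ms {v = w} i<p | cutoff-≤ ms {v = w} (<⇒≤ i<p) = steps i i<p
    ... | inj₂ refl
      rewrite cutoff-suc as i c | cutoff-suc bs i e
            | cutoff-suc ms i w | cutoff-≤ ms {v = w} (≤-refl {i}) =
      sandwichStep w-lower w-upper ≤-refl (Ack-<-suc c e) refl

  NF-in-penultimate-window : ∀ {m c e p as bs ms} → Sandwich k m (suc p) as bs ms →
    as (suc p) ≡ suc c →
    Ack k c (ms p) ≤ Ack k c e → Ack k c e < Ack k (suc c) (ms p) →
    NF k (Ack k c e) c e 0
  NF-in-penultimate-window {m} {c} {e} {p} {as} {bs} {ms} sw aₙ≡c+1 w-lower w-upper =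
    extend-sandwich {as = as} {bs} (Sandwich.m₀≡0 sw) retarget w-lower w-upper
    where
    w = Ack k c e
    w<m : w < m
    w<m = <-≤-trans w-upper
            (subst (λ a → Ack k a (ms p) ≤ m) aₙ≡c+1 (SandwichStep.base-lower (stepAt sw p ≤-refl)))
    retarget : ∀ i → i < p → SandwichStep k w (as (suc i)) (bs (suc i)) (ms i) (ms (suc i))
    retarget i i<p =
      step-retarget stᵢ
        (≤-trans (ms-mono sw i<p (n≤1+n p)) (≤-trans (<⇒≤ (Ack-inflationary c (ms p))) w-lower))
        (<-trans w<m (SandwichStep.bound-upper stᵢ))
      where stᵢ = stepAt sw i (m<n⇒m<1+n i<p)

  NF-above-value : ∀ {m c b e p as bs ms} → NFWith k m (suc c) b 0 (suc p) as bs ms →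
    Ack k c m ≤ Ack k c e → Ack k c e < Ack k (suc c) (suc b) →
    NF k (Ack k c e) c e 0
  NF-above-value {m} {c} {b} {e} {p} {as} {bs} {ms} nf w-lower w-upper =
    extend-sandwich {as = as} {bs} (Sandwich.m₀≡0 sandwich) retarget
      (subst (λ t → Ack k c t ≤ w) (sym mₙ≡m) w-lower)
      (subst (λ t → w < Ack k (suc c) t) (sym mₙ≡m)
        (<-≤-trans w-upper (Ack-monoʳ-≤ (suc c) b<m)))
    where
    open NFWith nf
    w = Ack k c e
    mₙ≡m : ms (suc p) ≡ m
    mₙ≡m = NFWith⇒ms≡m nf
    m≡A[c+1,b] : m ≡ Ack k (suc c) b
    m≡A[c+1,b] = trans eqn (+-identityʳ _)
    b<m : b < m
    b<m = subst (b <_) (sym m≡A[c+1,b]) (Ack-inflationary (suc c) b)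
    m≤w : m ≤ w
    m≤w = ≤-trans (<⇒≤ (Ack-inflationary c m)) w-lower
    retarget : ∀ i → i < suc p → SandwichStep k w (as (suc i)) (bs (suc i)) (ms i) (ms (suc i))
    retarget i i<n =
      step-retarget stᵢ (≤-trans (step-value≤ stᵢ) m≤w)
        (<-≤-trans w-upper
          (Ack-suc-≤-coarser {b = b} c+1≤aᵢ (≤-reflexive (sym m≡A[c+1,b]))
            (SandwichStep.bound-upper stᵢ)))
      where
      stᵢ = stepAt sandwich i i<n
      c+1≤aᵢ : suc c ≤ as (suc i)
      c+1≤aᵢ = subst (_≤ as (suc i)) (sym a≡aₙ) (as-antitone sandwich (m<1+n⇒m≤n i<n) ≤-refl)

lemma3p6 : (k : ℕ) → 2 ≤ k → (a b e m n : ℕ) → 1 ≤ a →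
    (as bs ms : ℕ → ℕ) → NFWith k m a b 0 n as bs ms →
    ((Ack k (a ∸ 1) (ms (n ∸ 1)) ≤ Ack k (a ∸ 1) e
        × Ack k (a ∸ 1) e < Ack k a (ms (n ∸ 1)))
     ⊎ (Ack k (a ∸ 1) m ≤ Ack k (a ∸ 1) e
        × Ack k (a ∸ 1) e < Ack k a (suc b))) →
    NF k (Ack k (a ∸ 1) e) (a ∸ 1) e 0
lemma3p6 k 1<k (suc c) b e m zero _ as bs ms nf _
  with () ← Sandwich.n≥1 (NFWith.sandwich nf)
lemma3p6 k 1<k (suc c) b e m (suc p) _ as bs ms nf (inj₁ (w-lower , w-upper)) =
  NF-in-penultimate-window 1<k (NFWith.sandwich nf) (sym (NFWith.a≡aₙ nf)) w-lower w-upper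
lemma3p6 k 1<k (suc c) b e m (suc p) _ as bs ms nf (inj₂ (w-lower , w-upper)) =
  NF-above-value 1<k nf w-lower w-upper
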